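{- Let $\mathcal{C}$ be an $(s,\kappa)$-disjointness-expressing class of graphs. Then any proof labeling scheme for $\mathcal{C}$ has complexity $\Omega\left(\frac{n^{\kappa}}{s}\right)$. In particular, if $s$ is a constant and $\kappa=1$, the complexity is $\Omega(n)$.
   Context: All graphs are finite, simple and connected; $N[S]$ denotes the closed neighbourhood of a vertex set $S$. Disjointness-expressing: a class $\mathcal{C}$ is $(s,\kappa)$-disjointness-expressing if for some constant $\alpha>0$, for every positive integer $N$ and every $X\subseteq\{1,\dots,N\}$ one can define graphs $L(X)$ and $R(X)$, each containing a labelled set $S$ of special vertices, such that for all $A,B\subseteq\{1,\dots,N\}$: (i) the graph $g(L(A),R(B))$ obtained by identifying each vertex of $S$ in $L(A)$ with the corresponding vertex of $S$ in $R(B)$ is connected and has at most $\alpha N^{1/\kappa}$ vertices; (ii) the subgraph of $g(L(A),R(B))$ induced by $N[S]$ is independent of $A$ and $B$ (for all $A,A',B,B'$ there is an isomorphism between the corresponding induced subgraphs that is the identity on $S$) and has at most $s$ vertices; (iii) $g(L(A),R(B))\in\mathcal{C}$ if and only if $A\cap B=\emptyset$. Local certification: in an $n$-vertex graph $G$ the vertices carry distinct identifiers from $\{1,\dots,\mathrm{poly}(n)\}$. A proof is a map $P:V(G)\to\{0,1\}^*$, of size the maximum certificate length. A verifier maps $(G,P,v)$ to $\{0,1\}$ and is local if the output at $v$ depends only on the identifier of $v$ and the identifiers and certificates of vertices in $N[v]$. A proof labeling scheme for $\mathcal{C}$ is a prover (assigning a proof to each $G\in\mathcal{C}$) and a local verifier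 such that all vertices accept the prover's proof whenever $G\in\mathcal{C}$, and whenever $G\notin\mathcal{C}$ every proof is rejected by some vertex. Its complexity is the maximum size of a proof given by the prover to an $n$-vertex graph of $\mathcal{C}$, as a function of $n$. -}

module Defs where

open import Data.Nat using (ℕ; zero; suc; _+_; _*_; _^_; _≤_; _⊔_)
open import Data.Bool using (Bool; true; false; _∨_; T)
open import Data.Fin using (Fin; zero; suc; splitAt; _↑ˡ_; _↑ʳ_; _≟_)
open import Data.Fin.Subset using (Subset; _∩_; Empty; ∣_∣)
open import Data.Vec using (tabulate)
open import Data.Maybe using (Maybe; just; nothing)
open import Data.Sum using (_⊎_; inj₁; inj₂)
open import Data.Product using (Σ; _×_; _,_; proj₁; proj₂; ∃)
open import Data.List using (List; length)
open import Relation.Nullary using (¬_)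
open import Relation.Nullary.Decidable using (⌊_⌋)
open import Relation.Binary.PropositionalEquality using (_≡_; refl; cong₂)

record Graph : Set where
  field
    n      : ℕ
    adj    : Fin n → Fin n → Bool
    sym    : ∀ u v → adj u v ≡ adj v u
    irrefl : ∀ v → adj v v ≡ false
open Graph public

Vertex : Graph → Set
Vertex G = Fin (n G)

data Reach (G : Graph) : Vertex G → Vertex G → Set where
  here : ∀ {v} → Reach G v v
  step : ∀ {u w v} → adj G u w ≡ true → Reach G w v → Reach G u v

Connected : Graph → Set
Connected G = ∀ u v → Reach G u v

anyFin : ∀ {k} → (Fin k → Bool) → Bool
anyFin {zero}  f = false
anyFin {suc k} f = f zero ∨ anyFin (λ i → f (suc i))

maxFin : ∀ {k} → (Fin k → ℕ) → ℕ
maxFin {zero}  f = 0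
maxFin {suc k} f = f zero ⊔ maxFin (λ i → f (suc i))

-- Closed neighbourhood N[S] of a labelled vertex set S = image of σ

inNS : (G : Graph) {k : ℕ} → (Fin k → Vertex G) → Vertex G → Bool
inNS G σ v = anyFin (λ s → ⌊ σ s ≟ v ⌋ ∨ adj G (σ s) v)

NS : (G : Graph) {k : ℕ} → (Fin k → Vertex G) → Subset (n G)
NS G σ = tabulate (inNS G σ)

NSVert : (G : Graph) {k : ℕ} → (Fin k → Vertex G) → Set
NSVert G σ = Σ (Vertex G) (λ v → T (inNS G σ v))

record IsoFixingS (G : Graph) (G' : Graph) {k : ℕ}
                  (σ : Fin k → Vertex G) (σ' : Fin k → Vertex G') : Set where
  field
    to      : NSVert G σ → NSVert G' σ'
    from    : NSVert G' σ' → NSVert G σ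
    from∘to : ∀ x → proj₁ (from (to x)) ≡ proj₁ x
    to∘from : ∀ y → proj₁ (to (from y)) ≡ proj₁ y
    fixS    : ∀ s x → proj₁ x ≡ σ s → proj₁ (to x) ≡ σ' s
    adjPres : ∀ x y → adj G (proj₁ x) (proj₁ y) ≡ adj G' (proj₁ (to x)) (proj₁ (to y))

-- Graphs with a labelled set S of k special vertices:
-- vertex set Fin (k + p), the first k vertices being S (labelled 0..k-1).

record SGraph (k : ℕ) : Set where
  field
    p      : ℕ
    sadj   : Fin (k + p) → Fin (k + p) → Bool
    ssym   : ∀ u v → sadj u v ≡ sadj v u
    sirrefl : ∀ v → sadj v v ≡ false
open SGraph public

liftAdj : ∀ {m} → (Fin m → Fin m → Bool) → Maybe (Fin m) → Maybe (Fin m) → Bool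
liftAdj a (just x) (just y) = a x y
liftAdj a _        _        = false

liftAdj-sym : ∀ {m} (a : Fin m → Fin m → Bool) → (∀ u v → a u v ≡ a v u) →
              ∀ x y → liftAdj a x y ≡ liftAdj a y x
liftAdj-sym a sy (just x) (just y) = sy x y
liftAdj-sym a sy (just x) nothing  = refl
liftAdj-sym a sy nothing  (just y) = refl
liftAdj-sym a sy nothing  nothing  = refl

liftAdj-irr : ∀ {m} (a : Fin m → Fin m → Bool) → (∀ u → a u u ≡ false) →
              ∀ x → liftAdj a x x ≡ false
liftAdj-irr a ir (just x) = ir x
liftAdj-irr a ir nothing  = refl

-- Gluing: vertex set Fin (k + (p + q)): S, then private vertices of L, then of R.
module _ {k : ℕ} (L R : SGraph k) where
  private
    pL = p L
    pR = p R

  toL : Fin (k + (pL + pR)) → Maybe (Fin (k + pL))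
  toL v with splitAt k v
  ... | inj₁ s = just (s ↑ˡ pL)
  ... | inj₂ r with splitAt pL r
  ...   | inj₁ l = just (k ↑ʳ l)
  ...   | inj₂ _ = nothing

  toR : Fin (k + (pL + pR)) → Maybe (Fin (k + pR))
  toR v with splitAt k v
  ... | inj₁ s = just (s ↑ˡ pR)
  ... | inj₂ r with splitAt pL r
  ...   | inj₁ _ = nothing
  ...   | inj₂ t = just (k ↑ʳ t)

  glueAdj : Fin (k + (pL + pR)) → Fin (k + (pL + pR)) → Bool
  glueAdj u v = liftAdj (sadj L) (toL u) (toL v) ∨ liftAdj (sadj R) (toR u) (toR v)

  glue : Graph
  glue = record
    { n      = k + (pL + pR)
    ; adj    = glueAdj
    ; sym    = λ u v → cong₂ _∨_ (liftAdj-sym (sadj L) (ssym L) (toL u) (toL v))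
                                 (liftAdj-sym (sadj R) (ssym R) (toR u) (toR v))
    ; irrefl = λ v → cong₂ _∨_ (liftAdj-irr (sadj L) (sirrefl L) (toL v))
                               (liftAdj-irr (sadj R) (sirrefl R) (toR v))
    }

  σglue : Fin k → Vertex glue
  σglue s = s ↑ˡ (pL + pR)

-- (s, κ)-disjointness-expressing classes.
-- α is taken to be a positive natural number (WLOG, the bound is monotone in α)
-- and "n ≤ α N^{1/κ}" is written as  n ^ κ ≤ α ^ κ * N.

GraphClass : Set₁
GraphClass = Graph → Set

record DisjExpr (s κ : ℕ) (𝒞 : GraphClass) : Set₁ where
  field
    α     : ℕ
    α-pos : 1 ≤ α
    k     : ℕ → ℕ
    Lg    : (N : ℕ) → Subset N → SGraph (k N)
    Rg    : (N : ℕ) → Subset N → SGraph (k N)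
    connected : ∀ N → 1 ≤ N → ∀ A B → Connected (glue (Lg N A) (Rg N B))
    small     : ∀ N → 1 ≤ N → ∀ A B → n (glue (Lg N A) (Rg N B)) ^ κ ≤ α ^ κ * N
    nbhd-iso  : ∀ N → 1 ≤ N → ∀ A B A' B' →
                IsoFixingS (glue (Lg N A) (Rg N B)) (glue (Lg N A') (Rg N B'))
                           (σglue (Lg N A) (Rg N B)) (σglue (Lg N A') (Rg N B'))
    nbhd-size : ∀ N → 1 ≤ N → ∀ A B →
                ∣ NS (glue (Lg N A) (Rg N B)) (σglue (Lg N A) (Rg N B)) ∣ ≤ s
    member⇒disj : ∀ N → 1 ≤ N → ∀ A B → 𝒞 (glue (Lg N A) (Rg N B)) → Empty (A ∩ B)
    disj⇒member : ∀ N → 1 ≤ N → ∀ A B → Empty (A ∩ B) → 𝒞 (glue (Lg N A) (Rg N B))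

Ids : Graph → Set
Ids G = Vertex G → ℕ

ValidIds : ℕ → (G : Graph) → Ids G → Set
ValidIds c G id = (∀ u v → id u ≡ id v → u ≡ v) × (∀ v → 1 ≤ id v × id v ≤ n G ^ c)

Proof : Graph → Set
Proof G = Vertex G → List Bool

proofSize : (G : Graph) → Proof G → ℕ
proofSize G P = maxFin (λ v → length (P v))

InN : (G : Graph) → Vertex G → Vertex G → Set
InN G v u = u ≡ v ⊎ adj G v u ≡ true

Verifier : Set
Verifier = (G : Graph) → Ids G → Proof G → Vertex G → Bool

SameView : (G : Graph) → Ids G → Proof G → Vertex G →
           (G' : Graph) → Ids G' → Proof G' → Vertex G' → Set
SameView G id P v G' id' P' v' =
  (∀ u → InN G v u → ∃ λ u' → InN G' v' u' × id' u' ≡ id u × P' u' ≡ P u) ×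
  (∀ u' → InN G' v' u' → ∃ λ u → InN G v u × id u ≡ id' u' × P u ≡ P' u')

Local : ℕ → Verifier → Set
Local c V = ∀ G (id : Ids G) (P : Proof G) v G' (id' : Ids G') (P' : Proof G') v' →
  Connected G → ValidIds c G id → Connected G' → ValidIds c G' id' →
  id v ≡ id' v' → SameView G id P v G' id' P' v' → V G id P v ≡ V G' id' P' v'

record PLS (c : ℕ) (𝒞 : GraphClass) : Set₁ where
  field
    prover   : (G : Graph) → Connected G → (id : Ids G) → ValidIds c G id → 𝒞 G → Proof G
    verifier : Verifier
    local    : Local c verifier
    complete : ∀ G (conn : Connected G) id (vid : ValidIds c G id) (g∈ : 𝒞 G) v →
               verifier G id (prover G conn id vid g∈) v ≡ true
    sound    : ∀ G → Connected G → ∀ id → ValidIds c G id → ¬ 𝒞 G →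
               ∀ (P : Proof G) → ∃ λ v → verifier G id P v ≡ false
open PLS public

module Submission where

-- For A ⊆ {1, …, N} let G_A = L(A) ∪ R(∁A), a graph of 𝒞, with identifiers depending only on
-- the position of a vertex in S, L or R. Suppose no G_A is a witness. Then either G_A has fewer
-- than n₀ vertices and is determined by R(∁A), or all its certificates have fewer than T bits
-- and G_A is summarised by the certificates on S together with the identifiers, certificates
-- and S-adjacencies of the at most s vertices of R(∁A) adjacent to S. If G_A and G_A′ have the
-- same summary, then the certificates of G_A (in the second case: of G_A on S ∪ L(A) and of G_A′
-- on R(∁A′)) are accepted on L(A) ∪ R(∁A′); hence A ∩ ∁A′ = ∅, i.e. A ⊆ A′. So equal summaries
-- force equal sets, whereas there are fewer than 2 ^ N summaries.

open import Defs renaming (sym to adj-sym)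
open import Data.Bool using (Bool; true; false; _∨_) renaming (T to IsTrue)
open import Data.Bool.Properties using (∨-identityʳ; ∨-zeroʳ)
open import Data.Empty using (⊥; ⊥-elim)
open import Data.Fin
  using (Fin; zero; suc; toℕ; _≟_; fromℕ<; combine; splitAt; _↑ˡ_; _↑ʳ_; funToFin; finToFun)
import Data.Fin.Properties as Fin
open import Data.Fin.Properties
  using ( combine-injective; ↑ˡ-injective; ↑ʳ-injective; any?; pigeonhole; finToFun-funToFin
        ; funToFin-finToFin; toℕ-fromℕ<; fromℕ<-toℕ; toℕ<n; toℕ-injective; ¬Fin0
        ; splitAt-↑ˡ; splitAt-↑ʳ; splitAt⁻¹-↑ˡ; splitAt⁻¹-↑ʳ)
open import Data.Fin.Subset using (Subset; ∣_∣; _∩_; ∁; Empty; _⊆_) renaming (_∈_ to _∈ₛ_; ⊥ to ∅)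
open import Data.Fin.Subset.Properties using (_∈?_; x∈p∩q⁺; x∉p⇒x∈∁p; ∉⊥; ∩-inverseʳ; ⊆-antisym)
open import Data.List using (List; []; _∷_; length; map)
import Data.List.Properties as List
open import Data.List.Properties using (length-map; map-injective)
open import Data.List.Membership.Propositional using (_∈_)
import Data.List.Relation.Unary.All as All
open All using (All)
open import Data.List.Relation.Unary.Any using (here; there)
open import Data.Maybe using (just; nothing)
open import Data.Nat
  using (ℕ; zero; suc; _+_; _*_; _^_; _≤_; _<_; _⊓_; z≤n; s≤s; s≤s⁻¹; _<?_; _≤?_; _%_)
open import Data.Nat.DivMod using (_mod_; m<n⇒m%n≡m; m%n<n)
open import Data.Nat.Properties
  using ( module ≤-Reasoning; ≤-trans; ≤-reflexive; <-≤-trans; ≤-<-trans; <⇒≤; ≰⇒>; ≮⇒≥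
        ; n≮0; n<1⇒n≡0; n≤0⇒n≡0; m<n⇒m<1+n; m≤n⇒m≤1+n
        ; m≤m⊔n; m≤n⊔m; m≤m+n; m≤n+m; m≤m*n; m≤n*m
        ; m+n≮m; suc-injective; even≢odd; +-comm; +-identityʳ; *-identityˡ; *-suc; *-distribˡ-+
        ; +-cancelˡ-≡; *-cancelˡ-≡; *-cancelˡ-<; +-mono-≤; +-monoˡ-≤; +-monoʳ-≤; +-mono-<-≤
        ; *-mono-≤; *-monoˡ-≤; *-monoʳ-≤; *-monoˡ-<; m^n≢0; m^n>0; ^-zeroˡ; ^-monoˡ-≤; ^-monoʳ-≤
        ; ^-*-assoc; ^-distribˡ-+-*)
open import Data.Nat.Tactic.RingSolver using (solve; solve-∀)
open import Data.Product using (Σ; _×_; _,_; ∃; proj₁; proj₂)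
open import Data.Sum using (inj₁; inj₂; [_,_]′)
open import Data.Vec using (Vec; tabulate; lookup)
open import Data.Vec.Properties using (lookup∘tabulate; tabulate∘lookup; tabulate-cong)
open import Function using (_∘_; id)
open import Relation.Nullary using (¬_; Dec; yes; no)
open import Relation.Nullary.Decidable using (⌊_⌋; _×-dec_; toWitness)
open import Relation.Binary.PropositionalEquality

anyFin-intro : ∀ {k} (f : Fin k → Bool) i → f i ≡ true → anyFin f ≡ true
anyFin-intro f zero    fi≡true rewrite fi≡true = refl
anyFin-intro f (suc i) fi≡true with f zero
... | true  = refl
... | false = anyFin-intro (f ∘ suc) i fi≡true

anyFin-elim : ∀ {k} (f : Fin k → Bool) → anyFin f ≡ true → ∃ λ i → f i ≡ true
anyFin-elim {suc k} f any≡true with f zero in f0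
... | true  = zero , f0
... | false with anyFin-elim (f ∘ suc) any≡true
...   | i , fi = suc i , fi

≤-maxFin : ∀ {k} (f : Fin k → ℕ) i → f i ≤ maxFin f
≤-maxFin f zero    = m≤m⊔n _ _
≤-maxFin f (suc i) = ≤-trans (≤-maxFin (f ∘ suc) i) (m≤n⊔m _ _)

k≤∣tabulate∣ : ∀ {k m} (q : Fin (k + m) → Bool) → (∀ s → q (s ↑ˡ m) ≡ true) → k ≤ ∣ tabulate q ∣
k≤∣tabulate∣ {zero}  q _  = z≤n
k≤∣tabulate∣ {suc k} q q↑ with q zero | q↑ zero
... | true | _ = s≤s (k≤∣tabulate∣ (q ∘ suc) (q↑ ∘ suc))

↑ˡ≢↑ʳ : ∀ {m n} {i : Fin m} {j : Fin n} → i ↑ˡ n ≢ m ↑ʳ j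
↑ˡ≢↑ʳ {m} {n} {i} {j} eq with trans (sym (splitAt-↑ˡ m i n)) (trans (cong (splitAt m) eq) (splitAt-↑ʳ m n j))
... | ()

select : ∀ {m} {X : Set} → (Fin m → Bool) → (Fin m → X) → List X
select {zero}  p f = []
select {suc m} p f with p zero
... | true  = f zero ∷ select (p ∘ suc) (f ∘ suc)
... | false = select (p ∘ suc) (f ∘ suc)

∈-select⁺ : ∀ {m} {X : Set} (p : Fin m → Bool) (f : Fin m → X) i → p i ≡ true → f i ∈ select p f
∈-select⁺ p f zero    pi with p zero
∈-select⁺ p f zero refl | .true = here refl
∈-select⁺ p f (suc i) pi with p zero
... | true  = there (∈-select⁺ (p ∘ suc) (f ∘ suc) i pi)
... | false = ∈-select⁺ (p ∘ suc) (f ∘ suc) i pi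

∈-select⁻ : ∀ {m} {X : Set} (p : Fin m → Bool) (f : Fin m → X) {x} → x ∈ select p f →
            ∃ λ i → p i ≡ true × f i ≡ x
∈-select⁻ {suc m} p f x∈ with p zero in p0 | x∈
... | true  | here refl = zero , p0 , refl
... | true  | there x∈′ with ∈-select⁻ (p ∘ suc) (f ∘ suc) x∈′
...   | i , pi , fi = suc i , pi , fi
∈-select⁻ {suc m} p f x∈ | false | x∈′ with ∈-select⁻ (p ∘ suc) (f ∘ suc) x∈′
...   | i , pi , fi = suc i , pi , fi

All-select : ∀ {m} {X : Set} {Q : X → Set} (p : Fin m → Bool) (f : Fin m → X) →
             (∀ i → Q (f i)) → All Q (select p f)
All-select {zero}  p f Qf = All.[]
All-select {suc m} p f Qf with p zero
... | true  = Qf zero All.∷ All-select (p ∘ suc) (f ∘ suc) (Qf ∘ suc)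
... | false = All-select (p ∘ suc) (f ∘ suc) (Qf ∘ suc)

length-select≤ : ∀ {m} {X : Set} (p q : Fin m → Bool) (f : Fin m → X) →
                 (∀ i → p i ≡ true → q i ≡ true) → length (select p f) ≤ ∣ tabulate q ∣
length-select≤ {zero}  p q f p⇒q = z≤n
length-select≤ {suc m} p q f p⇒q with p zero in p0 | q zero in q0
... | true  | true  = s≤s (length-select≤ (p ∘ suc) (q ∘ suc) (f ∘ suc) (p⇒q ∘ suc))
... | true  | false with trans (sym (p⇒q zero p0)) q0
...   | ()
length-select≤ {suc m} p q f p⇒q | false | true =
  m≤n⇒m≤1+n (length-select≤ (p ∘ suc) (q ∘ suc) (f ∘ suc) (p⇒q ∘ suc))
length-select≤ {suc m} p q f p⇒q | false | false =
  length-select≤ (p ∘ suc) (q ∘ suc) (f ∘ suc) (p⇒q ∘ suc)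

map-injectiveOn : ∀ {X Y : Set} {Q : X → Set} (f : X → Y) →
                  (∀ {x y} → Q x → Q y → f x ≡ f y → x ≡ y) →
                  ∀ {xs ys} → All Q xs → All Q ys → map f xs ≡ map f ys → xs ≡ ys
map-injectiveOn f inj All.[]         All.[]         eq = refl
map-injectiveOn f inj (qx All.∷ qxs) (qy All.∷ qys) eq =
  cong₂ _∷_ (inj qx qy (List.∷-injectiveˡ eq)) (map-injectiveOn f inj qxs qys (List.∷-injectiveʳ eq))

-- Encodings into Fin

bit : Bool → Fin 2
bit false = zero
bit true  = suc zero

unbit : Fin 2 → Bool
unbit zero       = false
unbit (suc zero) = true

bit-unbit : ∀ i → bit (unbit i) ≡ i
bit-unbit zero       = refl
bit-unbit (suc zero) = refl

bit-injective : ∀ {b b′} → bit b ≡ bit b′ → b ≡ b′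
bit-injective {false} {false} _ = refl
bit-injective {true}  {true}  _ = refl

funToFin-injective : ∀ {m n} (f g : Fin m → Fin n) → funToFin f ≡ funToFin g → ∀ i → f i ≡ g i
funToFin-injective f g eq i = begin
  f i                       ≡⟨ finToFun-funToFin f i ⟨
  finToFun (funToFin f) i   ≡⟨ cong (λ x → finToFun x i) eq ⟩
  finToFun (funToFin g) i   ≡⟨ finToFun-funToFin g i ⟩
  g i                       ∎
  where open ≡-Reasoning

funToFin-cong : ∀ {m n} {f g : Fin m → Fin n} → (∀ i → f i ≡ g i) → funToFin f ≡ funToFin g
funToFin-cong {zero}  f≗g = refl
funToFin-cong {suc m} f≗g = cong₂ combine (f≗g zero) (funToFin-cong (f≗g ∘ suc))

boolsCode : ∀ {k} → Vec Bool k → Fin (2 ^ k)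
boolsCode v = funToFin (bit ∘ lookup v)

boolsCode-injective : ∀ {k} (v w : Vec Bool k) → boolsCode v ≡ boolsCode w → v ≡ w
boolsCode-injective v w eq = begin
  v                   ≡⟨ tabulate∘lookup v ⟨
  tabulate (lookup v) ≡⟨ tabulate-cong (λ i → bit-injective (funToFin-injective _ _ eq i)) ⟩
  tabulate (lookup w) ≡⟨ tabulate∘lookup w ⟩
  w                   ∎
  where open ≡-Reasoning

subsetOf : ∀ {N} → Fin (2 ^ N) → Subset N
subsetOf i = tabulate (unbit ∘ finToFun i)

boolsCode-subsetOf : ∀ {N} (i : Fin (2 ^ N)) → boolsCode (subsetOf {N} i) ≡ i
boolsCode-subsetOf {N} i = begin
  funToFin (bit ∘ lookup (subsetOf {N} i)) ≡⟨ funToFin-cong {N} {2} bit-lookup ⟩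
  funToFin (finToFun {2} {N} i)             ≡⟨ funToFin-finToFin {N} {2} i ⟩
  i                                         ∎
  where
  open ≡-Reasoning
  bit-lookup : ∀ j → bit (lookup (subsetOf {N} i) j) ≡ finToFun i j
  bit-lookup j = trans (cong bit (lookup∘tabulate _ j)) (bit-unbit _)

subsetOf-injective : ∀ {N} (i j : Fin (2 ^ N)) → subsetOf {N} i ≡ subsetOf j → i ≡ j
subsetOf-injective {N} i j eq =
  trans (sym (boolsCode-subsetOf {N} i)) (trans (cong (boolsCode {N}) eq) (boolsCode-subsetOf {N} j))

-- zero marks the positions past the end of the list
padded : ∀ {L X} → List (Fin X) → Fin L → Fin (suc X)
padded []       _       = zero
padded (x ∷ xs) zero    = suc x
padded (x ∷ xs) (suc i) = padded xs i

padded-injective : ∀ {L X} (xs ys : List (Fin X)) → length xs ≤ L → length ys ≤ L →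
                   (∀ i → padded {L} xs i ≡ padded ys i) → xs ≡ ys
padded-injective          []       []       _         _         _  = refl
padded-injective {suc L} []       (y ∷ ys) _         _         eq with eq zero
... | ()
padded-injective {suc L} (x ∷ xs) []       _         _         eq with eq zero
... | ()
padded-injective {suc L} (x ∷ xs) (y ∷ ys) (s≤s xs≤) (s≤s ys≤) eq =
  cong₂ _∷_ (Fin.suc-injective (eq zero)) (padded-injective xs ys xs≤ ys≤ (eq ∘ suc))

listCode : ∀ L {X} → List (Fin X) → Fin (suc X ^ L)
listCode L xs = funToFin (padded {L} xs)

listCode-injective : ∀ L {X} (xs ys : List (Fin X)) → length xs ≤ L → length ys ≤ L →
                     listCode L xs ≡ listCode L ys → xs ≡ ys
listCode-injective L xs ys xs≤ ys≤ eq =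
  padded-injective xs ys xs≤ ys≤ (funToFin-injective (padded xs) (padded ys) eq)

certCode : ∀ T → List Bool → Fin (3 ^ T)
certCode T l = listCode T (map bit l)

certCode-injective : ∀ T (l l′ : List Bool) → length l ≤ T → length l′ ≤ T →
                     certCode T l ≡ certCode T l′ → l ≡ l′
certCode-injective T l l′ l≤ l′≤ eq = map-injective bit-injective
  (listCode-injective T (map bit l) (map bit l′)
    (subst (_≤ T) (sym (length-map bit l)) l≤) (subst (_≤ T) (sym (length-map bit l′)) l′≤) eq)

natCode : ∀ B → ℕ → Fin (suc B)
natCode B x = x mod suc B

natCode-injective : ∀ B {x y} → x < suc B → y < suc B → natCode B x ≡ natCode B y → x ≡ y
natCode-injective B {x} {y} x< y< eq = begin
  x                      ≡⟨ m<n⇒m%n≡m x< ⟨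
  x % suc B              ≡⟨ toℕ-fromℕ< (m%n<n x (suc B)) ⟨
  toℕ (natCode B x)      ≡⟨ cong toℕ eq ⟩
  toℕ (natCode B y)      ≡⟨ toℕ-fromℕ< (m%n<n y (suc B)) ⟩
  y % suc B              ≡⟨ m<n⇒m%n≡m y< ⟩
  y                      ∎
  where open ≡-Reasoning

-- junk value false out of range
adjℕ : ∀ {m} → (Fin m → Fin m → Bool) → ℕ → ℕ → Bool
adjℕ {m} a i j with i <? m | j <? m
... | yes i<m | yes j<m = a (fromℕ< i<m) (fromℕ< j<m)
... | _       | _       = false

adjℕ-toℕ : ∀ {m} (a : Fin m → Fin m → Bool) u v → adjℕ a (toℕ u) (toℕ v) ≡ a u v
adjℕ-toℕ {m} a u v with toℕ u <? m | toℕ v <? m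
... | yes u<m | yes v<m = cong₂ a (fromℕ<-toℕ u u<m) (fromℕ<-toℕ v v<m)
... | no u≮m  | _       = ⊥-elim (u≮m (toℕ<n u))
... | yes _   | no v≮m  = ⊥-elim (v≮m (toℕ<n v))

adjBits : ∀ B {m} → (Fin m → Fin m → Bool) → Fin B → Fin B → Fin 2
adjBits B a i j = bit (adjℕ a (toℕ i) (toℕ j))

tableCode : ∀ B {m} → (Fin m → Fin m → Bool) → Fin ((2 ^ B) ^ B)
tableCode B a = funToFin {B} {2 ^ B} λ i → funToFin {B} {2} (adjBits B a i)

tableCode-injective : ∀ B {m m′} (a : Fin m → Fin m → Bool) (a′ : Fin m′ → Fin m′ → Bool) →
                      tableCode B a ≡ tableCode B a′ → ∀ {i j} → i < B → j < B → adjℕ a i j ≡ adjℕ a′ i j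
tableCode-injective B a a′ eq {i} {j} i<B j<B =
  subst₂ (λ x y → adjℕ a x y ≡ adjℕ a′ x y) (toℕ-fromℕ< i<B) (toℕ-fromℕ< j<B)
    (bit-injective (funToFin-injective (adjBits B a (fromℕ< i<B)) (adjBits B a′ (fromℕ< i<B))
      (funToFin-injective _ _ eq (fromℕ< i<B)) (fromℕ< j<B)))

-- Identifiers

2n≤1+n² : ∀ n → 2 * n ≤ suc (n * n)
2n≤1+n² zero    = z≤n
2n≤1+n² (suc m) = begin
  2 * suc m                   ≡⟨ *-suc 2 m ⟩
  2 + (m + (m + 0))           ≡⟨ cong (λ x → 2 + (m + x)) (+-identityʳ m) ⟩
  2 + (m + m)                 ≤⟨ s≤s (s≤s (+-monoʳ-≤ m (m≤m*n m (suc m)))) ⟩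
  suc (suc m * suc m)         ∎
  where open ≤-Reasoning

<2n⇒≤n^c : ∀ {x n c} → 2 ≤ c → x < 2 * n → x ≤ n ^ c
<2n⇒≤n^c {x} {zero}  c≥2 x<0 = ⊥-elim (n≮0 x<0)
<2n⇒≤n^c {x} {suc m} {suc zero}    (s≤s ())
<2n⇒≤n^c {x} {suc m} {suc (suc c)} _ x<2n = begin
  x                         ≤⟨ s≤s⁻¹ (≤-trans x<2n (2n≤1+n² (suc m))) ⟩
  suc m * suc m             ≤⟨ *-monoʳ-≤ (suc m) (m≤m*n (suc m) (suc m ^ c) {{m^n≢0 (suc m) c}}) ⟩
  suc m * (suc m * suc m ^ c) ∎
  where open ≤-Reasoning

-- Identifiers of the private vertices of L and R, interleaved above those of S. For k = 0
-- they may collide, which is harmless since a connected glued graph without special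
-- vertex has a single side; shifting R unconditionally would break the bound n ^ c on
-- the one-vertex graph.
leftId rightId : ℕ → ℕ → ℕ
leftId  k t = suc (k + 2 * t)
rightId k t = suc (k + (1 ⊓ k + 2 * t))

k+2y≤2[k+z] : ∀ k {y z} → y ≤ z → k + 2 * y ≤ 2 * (k + z)
k+2y≤2[k+z] k {y} {z} y≤z = begin
  k + 2 * y       ≤⟨ +-mono-≤ (m≤n*m k 2) (*-monoʳ-≤ 2 y≤z) ⟩
  2 * k + 2 * z   ≡⟨ *-distribˡ-+ 2 k z ⟨
  2 * (k + z)     ∎
  where open ≤-Reasoning

specialId-bound : ∀ {k s} m → s < k → suc (suc s) ≤ 2 * (k + m)
specialId-bound {k} {s} m s<k = begin
  suc (suc s) ≤⟨ +-mono-≤ (≤-trans (s≤s z≤n) s<k) s<k ⟩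
  k + k       ≡⟨ cong (k +_) (+-identityʳ k) ⟨
  2 * k       ≤⟨ *-monoʳ-≤ 2 (m≤m+n k m) ⟩
  2 * (k + m) ∎
  where open ≤-Reasoning

leftId-bound : ∀ k {t m} → t < m → suc (leftId k t) ≤ 2 * (k + m)
leftId-bound k {t} {m} t<m = begin
  suc (suc (k + 2 * t)) ≡⟨ solve (k ∷ t ∷ []) ⟩
  k + 2 * suc t         ≤⟨ k+2y≤2[k+z] k t<m ⟩
  2 * (k + m)           ∎
  where open ≤-Reasoning

rightId-bound : ∀ k {t m} → t < m → suc (rightId k t) ≤ 2 * (k + m)
rightId-bound zero    t<m = leftId-bound zero t<m
rightId-bound (suc k) {t} {m} t<m = begin
  3 + (k + (1 + 2 * t))   ≡⟨ solve (k ∷ t ∷ []) ⟩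
  2 + (k + 2 * suc t)     ≤⟨ s≤s (s≤s (k+2y≤2[k+z] k t<m)) ⟩
  2 + 2 * (k + m)         ≡⟨ solve (k ∷ m ∷ []) ⟩
  2 * (suc k + m)         ∎
  where open ≤-Reasoning

leftId≡rightId⇒k≡0 : ∀ k {a b} → leftId k a ≡ rightId k b → k ≡ 0
leftId≡rightId⇒k≡0 zero    _  = refl
leftId≡rightId⇒k≡0 (suc k) {a} {b} eq = ⊥-elim (even≢odd a b (+-cancelˡ-≡ (suc k) _ _ (suc-injective eq)))

-- Graphs glued along S

σ∈N[σ] : (G : Graph) {k : ℕ} (σ : Fin k → Vertex G) → ∀ s → inNS G σ (σ s) ≡ true
σ∈N[σ] G σ s = anyFin-intro (λ s′ → ⌊ σ s′ ≟ σ s ⌋ ∨ adj G (σ s′) (σ s)) s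
  (cong (λ d → ⌊ d ⌋ ∨ adj G (σ s) (σ s)) (≡-≟-identity _≟_ {σ s} refl))

IsoFixingS-adj : ∀ {G G′ k} {σ : Fin k → Vertex G} {σ′ : Fin k → Vertex G′} →
                 IsoFixingS G G′ σ σ′ → ∀ s s′ → adj G (σ s) (σ s′) ≡ adj G′ (σ′ s) (σ′ s′)
IsoFixingS-adj {G} {G′} {σ = σ} {σ′} iso s s′ =
  trans (adjPres x x′) (cong₂ (adj G′) (fixS s x refl) (fixS s′ x′ refl))
  where
  open IsoFixingS iso
  x x′ : NSVert G σ
  x  = σ s  , subst IsTrue (sym (σ∈N[σ] G σ s)) _
  x′ = σ s′ , subst IsTrue (sym (σ∈N[σ] G σ s′)) _

Entry : ℕ → Set
Entry k = ℕ × List Bool × Vec Bool k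

module Glued {k : ℕ} (L R : SGraph k) where

  G : Graph
  G = glue L R

  inS : Fin k → Vertex G
  inS s = s ↑ˡ (p L + p R)

  inL : Fin (p L) → Vertex G
  inL t = k ↑ʳ (t ↑ˡ p R)

  inR : Fin (p R) → Vertex G
  inR t = k ↑ʳ (p L ↑ʳ t)

  data Part : Vertex G → Set where
    special : ∀ s → Part (inS s)
    left    : ∀ t → Part (inL t)
    right   : ∀ t → Part (inR t)

  part : ∀ v → Part v
  part v with splitAt k v in eq₁
  ... | inj₁ s = subst Part (splitAt⁻¹-↑ˡ eq₁) (special s)
  ... | inj₂ r with splitAt (p L) r in eq₂
  ...   | inj₁ t = subst Part (trans (cong (k ↑ʳ_) (splitAt⁻¹-↑ˡ eq₂)) (splitAt⁻¹-↑ʳ eq₁)) (left t)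
  ...   | inj₂ t = subst Part (trans (cong (k ↑ʳ_) (splitAt⁻¹-↑ʳ eq₂)) (splitAt⁻¹-↑ʳ eq₁)) (right t)

  byPart : ∀ {X : Set} → (Fin k → X) → (Fin (p L) → X) → (Fin (p R) → X) → Vertex G → X
  byPart fS fL fR = [ fS , [ fL , fR ]′ ∘ splitAt (p L) ]′ ∘ splitAt k

  module _ {X : Set} (fS : Fin k → X) (fL : Fin (p L) → X) (fR : Fin (p R) → X) where

    byPart-inS : ∀ s → byPart fS fL fR (inS s) ≡ fS s
    byPart-inS s rewrite splitAt-↑ˡ k s (p L + p R) = refl

    byPart-inL : ∀ t → byPart fS fL fR (inL t) ≡ fL t
    byPart-inL t rewrite splitAt-↑ʳ k (p L + p R) (t ↑ˡ p R) | splitAt-↑ˡ (p L) t (p R) = refl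

    byPart-inR : ∀ t → byPart fS fL fR (inR t) ≡ fR t
    byPart-inR t rewrite splitAt-↑ʳ k (p L + p R) (p L ↑ʳ t) | splitAt-↑ʳ (p L) (p R) t = refl

  private
    toL-inS : ∀ s → toL L R (inS s) ≡ just (s ↑ˡ p L)
    toL-inS s rewrite splitAt-↑ˡ k s (p L + p R) = refl
    toR-inS : ∀ s → toR L R (inS s) ≡ just (s ↑ˡ p R)
    toR-inS s rewrite splitAt-↑ˡ k s (p L + p R) = refl
    toL-inL : ∀ t → toL L R (inL t) ≡ just (k ↑ʳ t)
    toL-inL t rewrite splitAt-↑ʳ k (p L + p R) (t ↑ˡ p R) | splitAt-↑ˡ (p L) t (p R) = refl
    toR-inL : ∀ t → toR L R (inL t) ≡ nothing
    toR-inL t rewrite splitAt-↑ʳ k (p L + p R) (t ↑ˡ p R) | splitAt-↑ˡ (p L) t (p R) = refl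
    toL-inR : ∀ t → toL L R (inR t) ≡ nothing
    toL-inR t rewrite splitAt-↑ʳ k (p L + p R) (p L ↑ʳ t) | splitAt-↑ʳ (p L) (p R) t = refl
    toR-inR : ∀ t → toR L R (inR t) ≡ just (k ↑ʳ t)
    toR-inR t rewrite splitAt-↑ʳ k (p L + p R) (p L ↑ʳ t) | splitAt-↑ʳ (p L) (p R) t = refl

  adj-SL : ∀ s t → adj G (inS s) (inL t) ≡ sadj L (s ↑ˡ p L) (k ↑ʳ t)
  adj-SL s t rewrite toL-inS s | toL-inL t | toR-inS s | toR-inL t = ∨-identityʳ _

  adj-LL : ∀ t t′ → adj G (inL t) (inL t′) ≡ sadj L (k ↑ʳ t) (k ↑ʳ t′)
  adj-LL t t′ rewrite toL-inL t | toL-inL t′ | toR-inL t = ∨-identityʳ _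

  adj-SR : ∀ s t → adj G (inS s) (inR t) ≡ sadj R (s ↑ˡ p R) (k ↑ʳ t)
  adj-SR s t rewrite toL-inS s | toL-inR t | toR-inS s | toR-inR t = refl

  adj-RR : ∀ t t′ → adj G (inR t) (inR t′) ≡ sadj R (k ↑ʳ t) (k ↑ʳ t′)
  adj-RR t t′ rewrite toL-inR t | toR-inR t | toR-inR t′ = refl

  adj-LR : ∀ t t′ → adj G (inL t) (inR t′) ≡ false
  adj-LR t t′ rewrite toL-inL t | toL-inR t′ | toR-inL t = refl

  ident : Ids G
  ident = byPart (suc ∘ toℕ) (leftId k ∘ toℕ) (rightId k ∘ toℕ)

  ident-inS : ∀ s → ident (inS s) ≡ suc (toℕ s)
  ident-inS = byPart-inS _ _ _

  ident-inL : ∀ t → ident (inL t) ≡ leftId k (toℕ t)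
  ident-inL = byPart-inL _ _ _

  ident-inR : ∀ t → ident (inR t) ≡ rightId k (toℕ t)
  ident-inR = byPart-inR _ _ _

  inL≢inR : ∀ t t′ → inL t ≢ inR t′
  inL≢inR t t′ = ↑ˡ≢↑ʳ ∘ ↑ʳ-injective k _ _

  reach-from-left : (Fin k → ⊥) → ∀ {u v} → Reach G u v → ∃ (λ t → inL t ≡ u) → ∃ λ t → inL t ≡ v
  reach-from-left noS here                   isLeft   = isLeft
  reach-from-left noS (step {w = w} uw w⇝v) (t , refl) = reach-from-left noS w⇝v (neighbour (part w) uw)
    where
    neighbour : ∀ {w} → Part w → adj G (inL t) w ≡ true → ∃ λ t′ → inL t′ ≡ w
    neighbour (special s) _  = ⊥-elim (noS s)
    neighbour (left t′)   _  = t′ , refl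
    neighbour (right t′)  tw with trans (sym (adj-LR t t′)) tw
    ... | ()

  one-sided : k ≡ 0 → Connected G → Fin (p L) → Fin (p R) → ⊥
  one-sided k≡0 conn t t′ with reach-from-left (¬Fin0 ∘ subst Fin k≡0) (conn (inL t) (inR t′)) (t , refl)
  ... | t″ , eq = inL≢inR t″ t′ eq

  private
    identOf : ∀ {v} → Part v → ℕ
    identOf (special s) = suc (toℕ s)
    identOf (left t)    = leftId k (toℕ t)
    identOf (right t)   = rightId k (toℕ t)

    ident≡identOf : ∀ {v} (pv : Part v) → ident v ≡ identOf pv
    ident≡identOf (special s) = ident-inS s
    ident≡identOf (left t)    = ident-inL t
    ident≡identOf (right t)   = ident-inR t

  ident-injective : Connected G → ∀ u v → ident u ≡ ident v → u ≡ v
  ident-injective conn u v eq =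
    injective (part u) (part v) (trans (sym (ident≡identOf (part u))) (trans eq (ident≡identOf (part v))))
    where
    special≢ : ∀ s x → suc (toℕ s) ≢ suc (k + x)
    special≢ s x eq = m+n≮m k x (subst (_< k) (suc-injective eq) (toℕ<n s))

    injective : ∀ {u v} (pu : Part u) (pv : Part v) → identOf pu ≡ identOf pv → u ≡ v
    injective (special s) (special s′) eq = cong inS (toℕ-injective (suc-injective eq))
    injective (special s) (left t)     eq = ⊥-elim (special≢ s _ eq)
    injective (special s) (right t)    eq = ⊥-elim (special≢ s _ eq)
    injective (left t)    (special s)  eq = ⊥-elim (special≢ s _ (sym eq))
    injective (right t)   (special s)  eq = ⊥-elim (special≢ s _ (sym eq))
    injective (left t)    (left t′)    eq =
      cong inL (toℕ-injective (*-cancelˡ-≡ _ _ 2 (+-cancelˡ-≡ k _ _ (suc-injective eq))))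
    injective (right t)   (right t′)   eq =
      cong inR (toℕ-injective (*-cancelˡ-≡ _ _ 2
        (+-cancelˡ-≡ (1 ⊓ k) _ _ (+-cancelˡ-≡ k _ _ (suc-injective eq)))))
    injective (left t)    (right t′)   eq =
      ⊥-elim (one-sided (leftId≡rightId⇒k≡0 k {toℕ t} {toℕ t′} eq) conn t t′)
    injective (right t)   (left t′)    eq =
      ⊥-elim (one-sided (leftId≡rightId⇒k≡0 k {toℕ t′} {toℕ t} (sym eq)) conn t′ t)

  ident<2n : ∀ v → ident v < 2 * n G
  ident<2n v = subst (_< 2 * n G) (sym (ident≡identOf (part v))) (bound (part v))
    where
    bound : ∀ {v} (pv : Part v) → identOf pv < 2 * n G
    bound (special s) = specialId-bound (p L + p R) (toℕ<n s)
    bound (left t)    = leftId-bound k (≤-trans (toℕ<n t) (m≤m+n _ _))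
    bound (right t)   = rightId-bound k (≤-trans (toℕ<n t) (m≤n+m _ _))

  ident-valid : ∀ c → 2 ≤ c → Connected G → ValidIds c G ident
  ident-valid c c≥2 conn = ident-injective conn , λ v → positive v , <2n⇒≤n^c c≥2 (ident<2n v)
    where
    positive : ∀ v → 1 ≤ ident v
    positive v = subst (1 ≤_) (sym (ident≡identOf (part v))) (identOf-positive (part v))
      where
      identOf-positive : ∀ {v} (pv : Part v) → 1 ≤ identOf pv
      identOf-positive (special _) = s≤s z≤n
      identOf-positive (left _)    = s≤s z≤n
      identOf-positive (right _)   = s≤s z≤n

  k≤∣N[S]∣ : k ≤ ∣ NS G inS ∣
  k≤∣N[S]∣ = k≤∣tabulate∣ (inNS G inS) (σ∈N[σ] G inS)

  entry : Proof G → Vertex G → Entry k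
  entry P v = ident v , P v , tabulate (λ s → adj G (inS s) v)

  onBoundary : Vertex G → Bool
  onBoundary = byPart (λ _ → false) (λ _ → false) (λ t → anyFin λ s → adj G (inS s) (inR t))

  -- the private vertices of R adjacent to S, as seen by their neighbours in S
  boundary : Proof G → List (Entry k)
  boundary P = select onBoundary (entry P)

  onBoundary-inR : ∀ t → onBoundary (inR t) ≡ anyFin (λ s → adj G (inS s) (inR t))
  onBoundary-inR = byPart-inR _ _ _

  onBoundary⇒right : ∀ {v} → Part v → onBoundary v ≡ true → ∃ λ t → inR t ≡ v
  onBoundary⇒right (special s) b with trans (sym (byPart-inS _ _ _ s)) b
  ... | ()
  onBoundary⇒right (left t)    b with trans (sym (byPart-inL _ _ _ t)) b
  ... | ()
  onBoundary⇒right (right t)   _ = t , refl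

  length-boundary≤ : ∀ P → length (boundary P) ≤ ∣ NS G inS ∣
  length-boundary≤ P = length-select≤ onBoundary (inNS G inS) (entry P) λ v b → onBoundary⇒N[S] (part v) b
    where
    onBoundary⇒N[S] : ∀ {v} → Part v → onBoundary v ≡ true → inNS G inS v ≡ true
    onBoundary⇒N[S] pv b with onBoundary⇒right pv b
    ... | t , refl with anyFin-elim (λ s → adj G (inS s) (inR t)) (trans (sym (onBoundary-inR t)) b)
    ...   | s , st = anyFin-intro (λ s′ → ⌊ inS s′ ≟ inR t ⌋ ∨ adj G (inS s′) (inR t)) s
                        (trans (cong (⌊ inS s ≟ inR t ⌋ ∨_) st) (∨-zeroʳ _))

-- Local verification

Accepts : Verifier → (G : Graph) → Ids G → Proof G → Set
Accepts V G id P = ∀ v → V G id P v ≡ true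

Sees : (G : Graph) → Ids G → Proof G → Vertex G → ℕ → List Bool → Set
Sees G id P v i c = ∃ λ u → InN G v u × id u ≡ i × P u ≡ c

-- SameView G id P v G′ id′ P′ v′ is ViewIn in both directions.
ViewIn : (G : Graph) → Ids G → Proof G → Vertex G → (G′ : Graph) → Ids G′ → Proof G′ → Vertex G′ → Set
ViewIn G id P v G′ id′ P′ v′ = ∀ u → InN G v u → Sees G′ id′ P′ v′ (id u) (P u)

module _ {c 𝒞} (Π : PLS c 𝒞) where

  accepted-by-view : ∀ {G id P v G′ id′ P′ v′} →
    Connected G → ValidIds c G id → Connected G′ → ValidIds c G′ id′ → Accepts (verifier Π) G′ id′ P′ →
    id v ≡ id′ v′ → SameView G id P v G′ id′ P′ v′ → verifier Π G id P v ≡ true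
  accepted-by-view {G} {id} {P} {v} {G′} {id′} {P′} {v′} conn valid conn′ valid′ acc′ idv view =
    trans (local Π G id P v G′ id′ P′ v′ conn valid conn′ valid′ idv view) (acc′ v′)

  accepts⇒¬¬member : ∀ {G id P} → Connected G → ValidIds c G id → Accepts (verifier Π) G id P → ¬ ¬ 𝒞 G
  accepts⇒¬¬member {G} {id} {P} conn valid acc G∉𝒞 with sound Π G conn id valid G∉𝒞 P
  ... | v , rejected with trans (sym (acc v)) rejected
  ...   | ()

  accepts-iso : ∀ {G G′ id P} (φ : Vertex G′ → Vertex G) (ψ : Vertex G → Vertex G′) →
    (∀ x → φ (ψ x) ≡ x) →
    (∀ u v → adj G′ u v ≡ adj G (φ u) (φ v)) →
    Connected G → ValidIds c G id → Connected G′ → ValidIds c G′ (id ∘ φ) →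
    Accepts (verifier Π) G id P → Accepts (verifier Π) G′ (id ∘ φ) (P ∘ φ)
  accepts-iso {G} {G′} {id} {P} φ ψ φψ adjφ conn valid conn′ valid′ acc v =
    accepted-by-view conn′ valid′ conn valid acc refl (forth , back)
    where
    forth : ViewIn G′ (id ∘ φ) (P ∘ φ) v G id P (φ v)
    forth u (inj₁ refl) = φ u , inj₁ refl , refl , refl
    forth u (inj₂ vu)   = φ u , inj₂ (trans (sym (adjφ v u)) vu) , refl , refl

    back : ViewIn G id P (φ v) G′ (id ∘ φ) (P ∘ φ) v
    back u (inj₁ refl) = v , inj₁ refl , refl , refl
    back u (inj₂ vu)   = ψ u , inj₂ (trans (adjφ v (ψ u)) (trans (cong (adj G (φ v)) (φψ u)) vu)) ,
                         cong id (φψ u) , cong P (φψ u)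

module SameLeft {k} (L R₁ R₂ : SGraph k) where
  private
    module G₁ = Glued L R₁
    module G₂ = Glued L R₂

  module _ (P₁ : Proof G₁.G) (P₂ : Proof G₂.G)
           (agree-S : ∀ s → P₂ (G₂.inS s) ≡ P₁ (G₁.inS s))
           (agree-L : ∀ t → P₂ (G₂.inL t) ≡ P₁ (G₁.inL t)) where

    private
      Sees₂ : Vertex G₂.G → ℕ → List Bool → Set
      Sees₂ = Sees G₂.G G₂.ident P₂

      ident-S : ∀ s → G₂.ident (G₂.inS s) ≡ G₁.ident (G₁.inS s)
      ident-S s = trans (G₂.ident-inS s) (sym (G₁.ident-inS s))

      ident-L : ∀ t → G₂.ident (G₂.inL t) ≡ G₁.ident (G₁.inL t)
      ident-L t = trans (G₂.ident-inL t) (sym (G₁.ident-inL t))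

      adj-SL : ∀ s t → adj G₁.G (G₁.inS s) (G₁.inL t) ≡ adj G₂.G (G₂.inS s) (G₂.inL t)
      adj-SL s t = trans (G₁.adj-SL s t) (sym (G₂.adj-SL s t))

      adj-LS : ∀ t s → adj G₁.G (G₁.inL t) (G₁.inS s) ≡ adj G₂.G (G₂.inL t) (G₂.inS s)
      adj-LS t s = trans (adj-sym G₁.G _ _) (trans (adj-SL s t) (adj-sym G₂.G _ _))

      adj-LL : ∀ t t′ → adj G₁.G (G₁.inL t) (G₁.inL t′) ≡ adj G₂.G (G₂.inL t) (G₂.inL t′)
      adj-LL t t′ = trans (G₁.adj-LL t t′) (sym (G₂.adj-LL t t′))

    leftView : ∀ t → ViewIn G₁.G G₁.ident P₁ (G₁.inL t) G₂.G G₂.ident P₂ (G₂.inL t)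
    leftView t u (inj₁ refl) = G₂.inL t , inj₁ refl , ident-L t , agree-L t
    leftView t u (inj₂ tu)   = neighbour (G₁.part u) tu
      where
      neighbour : ∀ {u} → G₁.Part u → adj G₁.G (G₁.inL t) u ≡ true → Sees₂ (G₂.inL t) (G₁.ident u) (P₁ u)
      neighbour (G₁.special s) ts = G₂.inS s , inj₂ (trans (sym (adj-LS t s)) ts) , ident-S s , agree-S s
      neighbour (G₁.left t′)   tt = G₂.inL t′ , inj₂ (trans (sym (adj-LL t t′)) tt) , ident-L t′ , agree-L t′
      neighbour (G₁.right t′)  tt with trans (sym (G₁.adj-LR t t′)) tt
      ... | ()

    specialView : (∀ s s′ → adj G₁.G (G₁.inS s) (G₁.inS s′) ≡ adj G₂.G (G₂.inS s) (G₂.inS s′)) →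
      ∀ s → (∀ t → adj G₁.G (G₁.inS s) (G₁.inR t) ≡ true →
                   Sees₂ (G₂.inS s) (G₁.ident (G₁.inR t)) (P₁ (G₁.inR t))) →
      ViewIn G₁.G G₁.ident P₁ (G₁.inS s) G₂.G G₂.ident P₂ (G₂.inS s)
    specialView adj-SS s rightSeen u (inj₁ refl) = G₂.inS s , inj₁ refl , ident-S s , agree-S s
    specialView adj-SS s rightSeen u (inj₂ su)   = neighbour (G₁.part u) su
      where
      neighbour : ∀ {u} → G₁.Part u → adj G₁.G (G₁.inS s) u ≡ true → Sees₂ (G₂.inS s) (G₁.ident u) (P₁ u)
      neighbour (G₁.special s′) ss = G₂.inS s′ , inj₂ (trans (sym (adj-SS s s′)) ss) , ident-S s′ , agree-S s′
      neighbour (G₁.left t)     st = G₂.inL t , inj₂ (trans (sym (adj-SL s t)) st) , ident-L t , agree-L t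
      neighbour (G₁.right t)    st = rightSeen t st

module SameRight {k} (L₁ L₂ R : SGraph k) where
  private
    module G₁ = Glued L₁ R
    module G₂ = Glued L₂ R

  module _ (P₁ : Proof G₁.G) (P₂ : Proof G₂.G)
           (agree-S : ∀ s → P₂ (G₂.inS s) ≡ P₁ (G₁.inS s))
           (agree-R : ∀ t → P₂ (G₂.inR t) ≡ P₁ (G₁.inR t)) where

    private
      Sees₂ : Vertex G₂.G → ℕ → List Bool → Set
      Sees₂ = Sees G₂.G G₂.ident P₂

      ident-S : ∀ s → G₂.ident (G₂.inS s) ≡ G₁.ident (G₁.inS s)
      ident-S s = trans (G₂.ident-inS s) (sym (G₁.ident-inS s))

      ident-R : ∀ t → G₂.ident (G₂.inR t) ≡ G₁.ident (G₁.inR t)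
      ident-R t = trans (G₂.ident-inR t) (sym (G₁.ident-inR t))

      adj-SR : ∀ s t → adj G₁.G (G₁.inS s) (G₁.inR t) ≡ adj G₂.G (G₂.inS s) (G₂.inR t)
      adj-SR s t = trans (G₁.adj-SR s t) (sym (G₂.adj-SR s t))

      adj-RS : ∀ t s → adj G₁.G (G₁.inR t) (G₁.inS s) ≡ adj G₂.G (G₂.inR t) (G₂.inS s)
      adj-RS t s = trans (adj-sym G₁.G _ _) (trans (adj-SR s t) (adj-sym G₂.G _ _))

      adj-RR : ∀ t t′ → adj G₁.G (G₁.inR t) (G₁.inR t′) ≡ adj G₂.G (G₂.inR t) (G₂.inR t′)
      adj-RR t t′ = trans (G₁.adj-RR t t′) (sym (G₂.adj-RR t t′))

    rightView : ∀ t → ViewIn G₁.G G₁.ident P₁ (G₁.inR t) G₂.G G₂.ident P₂ (G₂.inR t)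
    rightView t u (inj₁ refl) = G₂.inR t , inj₁ refl , ident-R t , agree-R t
    rightView t u (inj₂ tu)   = neighbour (G₁.part u) tu
      where
      neighbour : ∀ {u} → G₁.Part u → adj G₁.G (G₁.inR t) u ≡ true → Sees₂ (G₂.inR t) (G₁.ident u) (P₁ u)
      neighbour (G₁.special s) ts = G₂.inS s , inj₂ (trans (sym (adj-RS t s)) ts) , ident-S s , agree-S s
      neighbour (G₁.left t′)   tt with trans (sym (G₁.adj-LR t′ t)) (trans (adj-sym G₁.G _ _) tt)
      ... | ()
      neighbour (G₁.right t′)  tt = G₂.inR t′ , inj₂ (trans (sym (adj-RR t t′)) tt) , ident-R t′ , agree-R t′

module _ {k} {L₁ R₁ L₂ R₂ : SGraph k} where
  private
    module X = Glued L₁ R₁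
    module Y = Glued L₂ R₂

  boundary-twin : (P₁ : Proof X.G) (P₂ : Proof Y.G) → X.boundary P₁ ≡ Y.boundary P₂ →
    ∀ s t → adj X.G (X.inS s) (X.inR t) ≡ true →
    ∃ λ t′ → adj Y.G (Y.inS s) (Y.inR t′) ≡ true ×
             Y.ident (Y.inR t′) ≡ X.ident (X.inR t) × P₂ (Y.inR t′) ≡ P₁ (X.inR t)
  boundary-twin P₁ P₂ same s t st
    with ∈-select⁻ Y.onBoundary (Y.entry P₂) (subst (X.entry P₁ (X.inR t) ∈_) same
           (∈-select⁺ X.onBoundary (X.entry P₁) (X.inR t)
             (trans (X.onBoundary-inR t) (anyFin-intro (λ s → adj X.G (X.inS s) (X.inR t)) s st))))
  ... | w , onY , same-entry with Y.onBoundary⇒right (Y.part w) onY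
  ...   | t′ , refl = t′ , adj-eq , cong proj₁ same-entry , cong (proj₁ ∘ proj₂) same-entry
    where
    adj-eq : adj Y.G (Y.inS s) (Y.inR t′) ≡ true
    adj-eq = begin
      adj Y.G (Y.inS s) (Y.inR t′)                           ≡⟨ lookup∘tabulate _ s ⟨
      lookup (tabulate λ s → adj Y.G (Y.inS s) (Y.inR t′)) s ≡⟨ cong (λ e → lookup (proj₂ (proj₂ e)) s) same-entry ⟩
      lookup (tabulate λ s → adj X.G (X.inS s) (X.inR t)) s  ≡⟨ lookup∘tabulate _ s ⟩
      adj X.G (X.inS s) (X.inR t)                            ≡⟨ st ⟩
      true                                                   ∎
      where open ≡-Reasoning

-- A = L₁ ∪ R₁ and B = L₂ ∪ R₂ are cut along S and pasted into C = L₁ ∪ R₂.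
module CutAndPaste {k} (L₁ R₁ L₂ R₂ : SGraph k) where
  private
    module A = Glued L₁ R₁
    module B = Glued L₂ R₂
    module C = Glued L₁ R₂

  crossProof : Proof A.G → Proof B.G → Proof C.G
  crossProof P₁ P₂ = C.byPart (P₁ ∘ A.inS) (P₁ ∘ A.inL) (P₂ ∘ B.inR)

  module _ {c 𝒞} (Π : PLS c 𝒞) (c≥2 : 2 ≤ c)
           (connA : Connected A.G) (connB : Connected B.G) (connC : Connected C.G)
           (P₁ : Proof A.G) (P₂ : Proof B.G)
           (accA : Accepts (verifier Π) A.G A.ident P₁) (accB : Accepts (verifier Π) B.G B.ident P₂)
           (agree-S : ∀ s → P₂ (B.inS s) ≡ P₁ (A.inS s))
           (adj-S : ∀ s s′ → adj A.G (A.inS s) (A.inS s′) ≡ adj C.G (C.inS s) (C.inS s′))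
           (same-boundary : A.boundary P₁ ≡ B.boundary P₂) where

    private
      Q : Proof C.G
      Q = crossProof P₁ P₂

      Q-inS : ∀ s → Q (C.inS s) ≡ P₁ (A.inS s)
      Q-inS = C.byPart-inS _ _ _

      Q-inL : ∀ t → Q (C.inL t) ≡ P₁ (A.inL t)
      Q-inL = C.byPart-inL _ _ _

      Q-inR : ∀ t → Q (C.inR t) ≡ P₂ (B.inR t)
      Q-inR = C.byPart-inR _ _ _

      Q-inS-B : ∀ s → Q (C.inS s) ≡ P₂ (B.inS s)
      Q-inS-B s = trans (Q-inS s) (sym (agree-S s))

      adj-SR : ∀ s t → adj C.G (C.inS s) (C.inR t) ≡ adj B.G (B.inS s) (B.inR t)
      adj-SR s t = trans (C.adj-SR s t) (sym (B.adj-SR s t))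

      ident-R : ∀ t → C.ident (C.inR t) ≡ B.ident (B.inR t)
      ident-R t = trans (C.ident-inR t) (sym (B.ident-inR t))

      seenInA : ∀ s t → adj C.G (C.inS s) (C.inR t) ≡ true →
                Sees A.G A.ident P₁ (A.inS s) (C.ident (C.inR t)) (Q (C.inR t))
      seenInA s t st with boundary-twin P₂ P₁ (sym same-boundary) s t (trans (sym (adj-SR s t)) st)
      ... | t′ , st′ , id≡ , P≡ = A.inR t′ , inj₂ st′ , trans id≡ (sym (ident-R t)) , trans P≡ (sym (Q-inR t))

      seenInC : ∀ s t → adj A.G (A.inS s) (A.inR t) ≡ true →
                Sees C.G C.ident Q (C.inS s) (A.ident (A.inR t)) (P₁ (A.inR t))
      seenInC s t st with boundary-twin P₁ P₂ same-boundary s t st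
      ... | t′ , st′ , id≡ , P≡ =
        C.inR t′ , inj₂ (trans (adj-SR s t′) st′) , trans (ident-R t′) id≡ , trans (Q-inR t′) P≡

      validA : ValidIds c A.G A.ident
      validA = A.ident-valid c c≥2 connA

      validB : ValidIds c B.G B.ident
      validB = B.ident-valid c c≥2 connB

      validC : ValidIds c C.G C.ident
      validC = C.ident-valid c c≥2 connC

      -- vertices of S and L₁ are compared with A, those of R₂ with B
      accepted : ∀ {v} → C.Part v → verifier Π C.G C.ident Q v ≡ true
      accepted (C.special s) = accepted-by-view Π connC validC connA validA accA
        (trans (C.ident-inS s) (sym (A.ident-inS s)))
        ( SameLeft.specialView L₁ R₂ R₁ Q P₁ (sym ∘ Q-inS) (sym ∘ Q-inL) (λ s s′ → sym (adj-S s s′))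
                               s (seenInA s)
        , SameLeft.specialView L₁ R₁ R₂ P₁ Q Q-inS Q-inL adj-S s (seenInC s))
      accepted (C.left t) = accepted-by-view Π connC validC connA validA accA
        (trans (C.ident-inL t) (sym (A.ident-inL t)))
        ( SameLeft.leftView L₁ R₂ R₁ Q P₁ (sym ∘ Q-inS) (sym ∘ Q-inL) t
        , SameLeft.leftView L₁ R₁ R₂ P₁ Q Q-inS Q-inL t)
      accepted (C.right t) = accepted-by-view Π connC validC connB validB accB (ident-R t)
        ( SameRight.rightView L₁ L₂ R₂ Q P₂ (sym ∘ Q-inS-B) (sym ∘ Q-inR) t
        , SameRight.rightView L₂ L₁ R₂ P₂ Q Q-inS-B Q-inR t)

    crossProof-accepted : Accepts (verifier Π) C.G C.ident (crossProof P₁ P₂)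
    crossProof-accepted v = accepted (C.part v)

liftAdj-cong : ∀ {m} {a b : Fin m → Fin m → Bool} → (∀ u v → a u v ≡ b u v) →
               ∀ x y → liftAdj a x y ≡ liftAdj b x y
liftAdj-cong a≗b (just u) (just v) = a≗b u v
liftAdj-cong a≗b (just _) nothing  = refl
liftAdj-cong a≗b nothing  _        = refl

sameTable-accepted : ∀ {k} (L R₁ R₂ : SGraph k) → p R₁ ≡ p R₂ →
  (∀ (u v : Fin (k + p R₁)) → adjℕ (sadj R₁) (toℕ u) (toℕ v) ≡ adjℕ (sadj R₂) (toℕ u) (toℕ v)) →
  ∀ {c 𝒞} (Π : PLS c 𝒞) → 2 ≤ c → Connected (glue L R₁) → Connected (glue L R₂) →
  ∃ (Accepts (verifier Π) (glue L R₁) (Glued.ident L R₁)) →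
  ∃ (Accepts (verifier Π) (glue L R₂) (Glued.ident L R₂))
-- Once p R₂ is matched with p R₁, the two glued graphs have the same vertices and identifiers,
-- and the identity is an isomorphism between them.
sameTable-accepted {k} L R₁@(record { sadj = a₁ }) R₂@(record { sadj = a₂ }) refl same
                   Π c≥2 conn₁ conn₂ (P , acc) =
  P , accepts-iso Π id id (λ _ → refl) adj₂≡adj₁ conn₁ (Glued.ident-valid L R₁ _ c≥2 conn₁)
                  conn₂ (Glued.ident-valid L R₂ _ c≥2 conn₂) acc
  where
  a₂≗a₁ : ∀ u v → a₂ u v ≡ a₁ u v
  a₂≗a₁ u v = trans (sym (adjℕ-toℕ a₂ u v)) (trans (sym (same u v)) (adjℕ-toℕ a₁ u v))

  toL≡ : ∀ u → toL L R₂ u ≡ toL L R₁ u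
  toL≡ u with splitAt k u
  ... | inj₁ _ = refl
  ... | inj₂ r with splitAt (p L) r
  ...   | inj₁ _ = refl
  ...   | inj₂ _ = refl

  toR≡ : ∀ u → toR L R₂ u ≡ toR L R₁ u
  toR≡ u with splitAt k u
  ... | inj₁ _ = refl
  ... | inj₂ r with splitAt (p L) r
  ...   | inj₁ _ = refl
  ...   | inj₂ _ = refl

  adj₂≡adj₁ : ∀ u v → adj (glue L R₂) u v ≡ adj (glue L R₁) u v
  adj₂≡adj₁ u v = cong₂ _∨_ (cong₂ (liftAdj (sadj L)) (toL≡ u) (toL≡ v))
                            (trans (cong₂ (liftAdj a₂) (toR≡ u) (toR≡ v))
                                   (liftAdj-cong a₂≗a₁ (toR L R₁ u) (toR L R₁ v)))

-- Counting

Empty-∩∁⇒⊆ : ∀ {N} {A B : Subset N} → Empty (A ∩ ∁ B) → A ⊆ B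
Empty-∩∁⇒⊆ {B = B} empty {x} x∈A with x ∈? B
... | yes x∈B = x∈B
... | no  x∉B = ⊥-elim (empty (x , x∈p∩q⁺ (x∈A , x∉p⇒x∈∁p x∉B)))

Empty-∩∁-self : ∀ {N} (A : Subset N) → Empty (A ∩ ∁ A)
Empty-∩∁-self A (x , x∈) = ∉⊥ (subst (x ∈ₛ_) (∩-inverseʳ A) x∈)

All-length≤0 : ∀ {X : Set} {Q : X → Set} {xs : List X} → length xs ≤ 0 → All Q xs
All-length≤0 {xs = []} _ = All.[]

n≤n^κ : ∀ n {κ} → 1 ≤ κ → n ≤ n ^ κ
n≤n^κ zero            _ = z≤n
n≤n^κ (suc m) {suc κ} _ = m≤m*n (suc m) (suc m ^ κ) {{m^n≢0 (suc m) κ}}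

∣S∣≤s : ∀ {s κ 𝒞} (D : DisjExpr s κ 𝒞) → ∀ N → 1 ≤ N → DisjExpr.k D N ≤ s
∣S∣≤s D N N≥1 = ≤-trans (Glued.k≤∣N[S]∣ (Lg N ∅) (Rg N ∅)) (nbhd-size N N≥1 _ _)
  where open DisjExpr D

smallCodes : ℕ → ℕ → ℕ
smallCodes s n₀ = n₀ * (2 ^ (s + n₀)) ^ (s + n₀)

entryCodes : ℕ → ℕ → ℕ → ℕ
entryCodes I T k = suc I * (3 ^ T * 2 ^ k)

bigCodes : ℕ → ℕ → ℕ → ℕ → ℕ
bigCodes s T I k = (3 ^ T) ^ k * suc (entryCodes I T k) ^ s

module Counting {s κ : ℕ} (κ≥1 : 1 ≤ κ) {𝒞 : GraphClass} (D : DisjExpr s κ 𝒞)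
                {c : ℕ} (c≥2 : 2 ≤ c) (Π : PLS c 𝒞) (n₀ T N : ℕ) (N≥1 : 1 ≤ N)
                (short : ∀ m → 1 ≤ s → 16 * DisjExpr.α D ^ κ * s * m < DisjExpr.α D ^ κ * N → m < T)
                (fits : smallCodes s n₀ + bigCodes s T (2 * (DisjExpr.α D ^ κ * N)) (DisjExpr.k D N) < 2 ^ N) where
  open DisjExpr D

  module Cross (A A′ : Subset N) = Glued (Lg N A) (Rg N (∁ A′))

  private
    a I K B : ℕ
    a = α ^ κ
    I = 2 * (a * N)
    K = k N
    B = s + n₀

  G : Subset N → Graph
  G A = Cross.G A A

  conn : ∀ A A′ → Connected (Cross.G A A′)
  conn A A′ = connected N N≥1 A (∁ A′)

  member : ∀ A → 𝒞 (G A)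
  member A = disj⇒member N N≥1 A (∁ A) (Empty-∩∁-self A)

  valid : ∀ A → ValidIds c (G A) (Cross.ident A A)
  valid A = Cross.ident-valid A A c c≥2 (conn A A)

  cert : ∀ A → Proof (G A)
  cert A = prover Π (G A) (conn A A) (Cross.ident A A) (valid A) (member A)

  cert-accepted : ∀ A → Accepts (verifier Π) (G A) (Cross.ident A A) (cert A)
  cert-accepted A = complete Π (G A) (conn A A) (Cross.ident A A) (valid A) (member A)

  Good : Subset N → Set
  Good A = n₀ ≤ n (G A) × n (G A) ^ κ ≤ 16 * a * s * proofSize (G A) (cert A)

  crossed⇒⊆ : ∀ A A′ → ∃ (Accepts (verifier Π) (Cross.G A A′) (Cross.ident A A′)) → A ⊆ A′
  crossed⇒⊆ A A′ (P , acc) = Empty-∩∁⇒⊆ λ nonempty →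
    accepts⇒¬¬member Π (conn A A′) (Cross.ident-valid A A′ c c≥2 (conn A A′)) acc
      (λ member → member⇒disj N N≥1 A (∁ A′) member nonempty)

  smallCode : ∀ A → p (Rg N (∁ A)) < n₀ → Fin (smallCodes s n₀)
  smallCode A p< = combine (fromℕ< p<) (tableCode B (sadj (Rg N (∁ A))))

  smallCode-injective : ∀ A A′ p< p<′ → smallCode A p< ≡ smallCode A′ p<′ → A ⊆ A′
  smallCode-injective A A′ p< p<′ eq with combine-injective (fromℕ< p<) _ (fromℕ< p<′) _ eq
  ... | same-p , same-table = crossed⇒⊆ A A′
    (sameTable-accepted (Lg N A) R R′ p≡ table≡ Π c≥2 (conn A A) (conn A A′) (cert A , cert-accepted A))
    where
    R R′ : SGraph K
    R  = Rg N (∁ A)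
    R′ = Rg N (∁ A′)

    p≡ : p R ≡ p R′
    p≡ = trans (sym (toℕ-fromℕ< p<)) (trans (cong toℕ same-p) (toℕ-fromℕ< p<′))

    inRange : ∀ (u : Fin (K + p R)) → toℕ u < B
    inRange u = <-≤-trans (toℕ<n u) (+-mono-≤ (∣S∣≤s D N N≥1) (<⇒≤ p<))

    table≡ : ∀ u v → adjℕ (sadj R) (toℕ u) (toℕ v) ≡ adjℕ (sadj R′) (toℕ u) (toℕ v)
    table≡ u v = tableCode-injective B (sadj R) (sadj R′) same-table (inRange u) (inRange v)

  ShortEntry : Entry K → Set
  ShortEntry (i , l , _) = i < suc I × length l ≤ T

  entryCode : Entry K → Fin (entryCodes I T K)
  entryCode (i , l , v) = combine (natCode I i) (combine (certCode T l) (boolsCode v))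

  entryCode-injective : ∀ {e e′} → ShortEntry e → ShortEntry e′ → entryCode e ≡ entryCode e′ → e ≡ e′
  entryCode-injective {i , l , v} {i′ , l′ , v′} (i< , l≤) (i′< , l′≤) eq
    with combine-injective (natCode I i) _ (natCode I i′) _ eq
  ... | i≡ , rest with combine-injective (certCode T l) (boolsCode v) (certCode T l′) (boolsCode v′) rest
  ...   | l≡ , v≡ = cong₂ _,_ (natCode-injective I i< i′< i≡)
                      (cong₂ _,_ (certCode-injective T l l′ l≤ l′≤ l≡) (boolsCode-injective v v′ v≡))

  ShortCerts : Subset N → Set
  ShortCerts A = (∀ t → length (cert A (Cross.inS A A t)) ≤ T) ×
                 All ShortEntry (Cross.boundary A A (cert A))

  bigCode : Subset N → Fin (bigCodes s T I K)
  bigCode A = combine (funToFin (certCode T ∘ cert A ∘ Cross.inS A A))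
                      (listCode s (map entryCode (Cross.boundary A A (cert A))))

  length-boundaryCodes≤s : ∀ A → length (map entryCode (Cross.boundary A A (cert A))) ≤ s
  length-boundaryCodes≤s A = begin
    length (map entryCode (Cross.boundary A A (cert A))) ≡⟨ length-map entryCode (Cross.boundary A A (cert A)) ⟩
    length (Cross.boundary A A (cert A))                 ≤⟨ Cross.length-boundary≤ A A (cert A) ⟩
    ∣ NS (G A) (Cross.inS A A) ∣                          ≤⟨ nbhd-size N N≥1 A (∁ A) ⟩
    s                                                    ∎
    where open ≤-Reasoning

  bigCode-injective : ∀ A A′ → ShortCerts A → ShortCerts A′ → bigCode A ≡ bigCode A′ → A ⊆ A′
  bigCode-injective A A′ (shortS , shortB) (shortS′ , shortB′) eq with combine-injective _ _ _ _ eq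
  ... | same-S , same-B = crossed⇒⊆ A A′
    (_ , CutAndPaste.crossProof-accepted (Lg N A) (Rg N (∁ A)) (Lg N A′) (Rg N (∁ A′)) Π c≥2
           (conn A A) (conn A′ A′) (conn A A′) (cert A) (cert A′) (cert-accepted A) (cert-accepted A′)
           agree-S (IsoFixingS-adj (nbhd-iso N N≥1 A (∁ A) A (∁ A′))) same-boundary)
    where
    agree-S : ∀ t → cert A′ (Cross.inS A′ A′ t) ≡ cert A (Cross.inS A A t)
    agree-S t = certCode-injective T _ _ (shortS′ t) (shortS t) (sym (funToFin-injective _ _ same-S t))

    same-boundary : Cross.boundary A A (cert A) ≡ Cross.boundary A′ A′ (cert A′)
    same-boundary = map-injectiveOn entryCode entryCode-injective shortB shortB′
      (listCode-injective s _ _ (length-boundaryCodes≤s A) (length-boundaryCodes≤s A′) same-B)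

  shortCerts : ∀ A → ¬ Good A → n₀ ≤ n (G A) → ShortCerts A
  shortCerts A bad n₀≤n with 1 ≤? s
  ... | yes s≥1 = (λ t → certs≤ (Cross.inS A A t)) ,
                  All-select (Cross.onBoundary A A) _ (λ v → ident< v , certs≤ v)
    where
    m<T : proofSize (G A) (cert A) < T
    m<T = short _ s≥1 (<-≤-trans (≰⇒> (λ n^κ≤ → bad (n₀≤n , n^κ≤))) (small N N≥1 A (∁ A)))

    certs≤ : ∀ v → length (cert A v) ≤ T
    certs≤ v = ≤-trans (≤-maxFin (length ∘ cert A) v) (<⇒≤ m<T)

    ident< : ∀ v → Cross.ident A A v < suc I
    ident< v = m<n⇒m<1+n (<-≤-trans (Cross.ident<2n A A v)
                 (*-monoʳ-≤ 2 (≤-trans (n≤n^κ (n (G A)) κ≥1) (small N N≥1 A (∁ A)))))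
  ... | no s≱1 = (λ t → ⊥-elim (¬Fin0 (subst Fin K≡0 t))) ,
                 All-length≤0 (≤-trans (Cross.length-boundary≤ A A (cert A)) N[S]≤0)
    where
    N[S]≤0 : ∣ NS (G A) (Cross.inS A A) ∣ ≤ 0
    N[S]≤0 = subst (_ ≤_) (n<1⇒n≡0 (≰⇒> s≱1)) (nbhd-size N N≥1 A (∁ A))

    K≡0 : K ≡ 0
    K≡0 = n≤0⇒n≡0 (≤-trans (Cross.k≤∣N[S]∣ A A) N[S]≤0)

  p<n₀ : ∀ A → n (G A) < n₀ → p (Rg N (∁ A)) < n₀
  p<n₀ A = ≤-<-trans (≤-trans (m≤n+m _ (p (Lg N A))) (m≤n+m _ K))

  code : ∀ A → Dec (n (G A) < n₀) → Fin (smallCodes s n₀ + bigCodes s T I K)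
  code A (yes n<n₀) = smallCode A (p<n₀ A n<n₀) ↑ˡ bigCodes s T I K
  code A (no  n≮n₀) = smallCodes s n₀ ↑ʳ bigCode A

  code-injective : ∀ A A′ → ¬ Good A → ¬ Good A′ → ∀ dA dA′ → code A dA ≡ code A′ dA′ → A ⊆ A′
  code-injective A A′ bad bad′ (yes n<n₀) (yes n′<n₀) eq =
    smallCode-injective A A′ (p<n₀ A n<n₀) (p<n₀ A′ n′<n₀) (↑ˡ-injective (bigCodes s T I K) _ _ eq)
  code-injective A A′ bad bad′ (no  n≮n₀) (no  n′≮n₀) eq =
    bigCode-injective A A′ (shortCerts A bad (≮⇒≥ n≮n₀)) (shortCerts A′ bad′ (≮⇒≥ n′≮n₀))
      (↑ʳ-injective (smallCodes s n₀) _ _ eq)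
  code-injective A A′ bad bad′ (yes _) (no _) eq = ⊥-elim (↑ˡ≢↑ʳ eq)
  code-injective A A′ bad bad′ (no _) (yes _) eq = ⊥-elim (↑ˡ≢↑ʳ (sym eq))

  good? : ∀ A → Dec (Good A)
  good? A = (n₀ ≤? n (G A)) ×-dec (n (G A) ^ κ ≤? 16 * a * s * proofSize (G A) (cert A))

  small? : ∀ A → Dec (n (G A) < n₀)
  small? A = n (G A) <? n₀

  goodGraph : Σ Graph λ G → Σ (Connected G) λ conn → Σ (Ids G) λ id → Σ (ValidIds c G id) λ vid →
              Σ (𝒞 G) λ g∈ → n₀ ≤ n G × n G ^ κ ≤ 16 * a * s * proofSize G (prover Π G conn id vid g∈)
  goodGraph with any? (λ i → good? (subsetOf {N} i))
  ... | yes (i , good-i) = G A , conn A A , Cross.ident A A , valid A , member A , good-i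
    where A = subsetOf i
  ... | no none with pigeonhole fits (λ i → code (subsetOf i) (small? (subsetOf i)))
  ...   | i , j , i<j , same = ⊥-elim (Fin.<⇒≢ i<j (subsetOf-injective i j
            (⊆-antisym (injective i j same) (injective j i (sym same)))))
    where
    injective : ∀ i j → code (subsetOf i) (small? (subsetOf i)) ≡ code (subsetOf j) (small? (subsetOf j)) →
                subsetOf i ⊆ subsetOf j
    injective i j =
      code-injective (subsetOf i) (subsetOf j) (none ∘ (i ,_)) (none ∘ (j ,_)) (small? _) (small? _)

-- Choice of parameters

n<2^n : ∀ n → n < 2 ^ n
n<2^n zero    = s≤s z≤n
n<2^n (suc n) = begin-strict
  suc n             <⟨ s≤s (n<2^n n) ⟩
  suc (2 ^ n)       ≤⟨ +-monoˡ-≤ (2 ^ n) (m^n>0 2 n) ⟩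
  2 ^ n + 2 ^ n     ≡⟨ cong (2 ^ n +_) (+-identityʳ (2 ^ n)) ⟨
  2 ^ suc n         ∎
  where open ≤-Reasoning

1+n²≤2^n : ∀ x → suc ((x + 5) * (x + 5)) ≤ 2 ^ (x + 5)
1+n²≤2^n zero    = toWitness {a? = 26 ≤? 32} _
1+n²≤2^n (suc x) = begin
  suc (suc y * suc y)          ≡⟨ expand y ⟩
  suc (y * y) + (y + y + 1)    ≤⟨ +-monoʳ-≤ (suc (y * y)) (+-monoˡ-≤ 1 2y≤y²) ⟩
  suc (y * y) + (y * y + 1)    ≡⟨ regroup (y * y) ⟩
  suc (y * y) + (suc (y * y) + 0) ≤⟨ +-mono-≤ (1+n²≤2^n x) (+-monoˡ-≤ 0 (1+n²≤2^n x)) ⟩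
  2 ^ suc y                    ∎
  where
  open ≤-Reasoning
  y : ℕ
  y = x + 5

  expand : ∀ y → suc (suc y * suc y) ≡ suc (y * y) + (y + y + 1)
  expand = solve-∀

  regroup : ∀ z → suc z + (z + 1) ≡ suc z + (suc z + 0)
  regroup = solve-∀

  2y≤y² : y + y ≤ y * y
  2y≤y² = begin
    y + y      ≡⟨ cong (y +_) (+-identityʳ y) ⟨
    2 * y      ≤⟨ *-monoˡ-≤ y (≤-trans (s≤s (s≤s z≤n)) (m≤n+m 5 x)) ⟩
    y * y      ∎

3^n≤2^2n : ∀ n → 3 ^ n ≤ 2 ^ (2 * n)
3^n≤2^2n n = ≤-trans (^-monoˡ-≤ n (s≤s (s≤s (s≤s z≤n)))) (≤-reflexive (^-*-assoc 2 2 n))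

+-<-2^ : ∀ {x y} a b → x < 2 ^ a → y ≤ 2 ^ b → x + y < 2 ^ suc (a + b)
+-<-2^ {x} {y} a b x< y≤ = begin-strict
  x + y                   <⟨ +-mono-<-≤ x< y≤ ⟩
  2 ^ a + 2 ^ b           ≤⟨ +-mono-≤ (^-monoʳ-≤ 2 (m≤m+n a b)) (^-monoʳ-≤ 2 (m≤n+m b a)) ⟩
  2 ^ (a + b) + 2 ^ (a + b) ≡⟨ cong (2 ^ (a + b) +_) (+-identityʳ (2 ^ (a + b))) ⟨
  2 ^ suc (a + b)         ∎
  where open ≤-Reasoning

-- T dominates s, 16 a (s + 1), n₀ + (s + n₀)² and 5, which is what makes certificates of
-- non-witnesses shorter than T and leaves fewer than 2 ^ N codes.
module Parameters (s a n₀ : ℕ) (a≥1 : 1 ≤ a) where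

  B T N : ℕ
  B = s + n₀
  T = 16 * a * suc s + (n₀ + B * B) + 5
  N = 8 * suc s * T

  private
    16a[1+s]≤T : 16 * a * suc s ≤ T
    16a[1+s]≤T = ≤-trans (m≤m+n _ (n₀ + B * B)) (m≤m+n _ 5)

    1+s≤T : suc s ≤ T
    1+s≤T = begin
      suc s              ≡⟨ *-identityˡ (suc s) ⟨
      1 * suc s          ≤⟨ *-monoˡ-≤ (suc s) (*-mono-≤ {1} {16} (s≤s z≤n) a≥1) ⟩
      16 * a * suc s     ≤⟨ 16a[1+s]≤T ⟩
      T                  ∎
      where open ≤-Reasoning

    smallCodes<2^T : smallCodes s n₀ < 2 ^ T
    smallCodes<2^T = begin-strict
      n₀ * (2 ^ B) ^ B        ≡⟨ cong (n₀ *_) (^-*-assoc 2 B B) ⟩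
      n₀ * 2 ^ (B * B)        <⟨ *-monoˡ-< (2 ^ (B * B)) {{m^n≢0 2 (B * B)}} (n<2^n n₀) ⟩
      2 ^ n₀ * 2 ^ (B * B)    ≡⟨ ^-distribˡ-+-* 2 n₀ (B * B) ⟨
      2 ^ (n₀ + B * B)        ≤⟨ ^-monoʳ-≤ 2 (≤-trans (m≤n+m _ (16 * a * suc s)) (m≤m+n _ 5)) ⟩
      2 ^ T                   ∎
      where open ≤-Reasoning

    1+I≤2^T : suc (2 * (a * N)) ≤ 2 ^ T
    1+I≤2^T = begin
      suc (2 * (a * (8 * suc s * T))) ≡⟨ cong suc (reassoc a s T) ⟩
      suc (16 * a * suc s * T)        ≤⟨ s≤s (*-monoˡ-≤ T 16a[1+s]≤T) ⟩
      suc (T * T)                     ≤⟨ 1+n²≤2^n (16 * a * suc s + (n₀ + B * B)) ⟩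
      2 ^ T                           ∎
      where
      open ≤-Reasoning
      reassoc : ∀ a s T → 2 * (a * (8 * suc s * T)) ≡ 16 * a * suc s * T
      reassoc = solve-∀

    1+entryCodes≤ : ∀ k → k ≤ s → suc (entryCodes (2 * (a * N)) T k) ≤ 2 ^ (4 * T)
    1+entryCodes≤ k k≤s = begin
      suc (suc I * (3 ^ T * 2 ^ k))
        ≤⟨ +-mono-≤ (m^n>0 2 e) (*-mono-≤ 1+I≤2^T (*-mono-≤ (3^n≤2^2n T) (^-monoʳ-≤ 2 k≤s))) ⟩
      2 ^ e + 2 ^ T * (2 ^ (2 * T) * 2 ^ s)
        ≡⟨ cong (2 ^ e +_) (trans (^-distribˡ-+-* 2 T (2 * T + s)) (cong (2 ^ T *_) (^-distribˡ-+-* 2 (2 * T) s))) ⟨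
      2 ^ e + 2 ^ e
        ≡⟨ cong (2 ^ e +_) (+-identityʳ (2 ^ e)) ⟨
      2 ^ suc e
        ≤⟨ ^-monoʳ-≤ 2 (≤-trans (≤-reflexive (regroup T s)) (+-monoʳ-≤ (3 * T) 1+s≤T)) ⟩
      2 ^ (3 * T + T)
        ≡⟨ cong (2 ^_) (+-comm (3 * T) T) ⟩
      2 ^ (4 * T) ∎
      where
      open ≤-Reasoning
      I e : ℕ
      I = 2 * (a * N)
      e = T + (2 * T + s)
      regroup : ∀ T s → suc (T + (2 * T + s)) ≡ 3 * T + suc s
      regroup = solve-∀

    bigCodes≤ : ∀ k → k ≤ s → bigCodes s T (2 * (a * N)) k ≤ 2 ^ (2 * T * s + 4 * T * s)
    bigCodes≤ k k≤s = begin
      (3 ^ T) ^ k * suc (entryCodes (2 * (a * N)) T k) ^ s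
        ≤⟨ *-mono-≤ (^-monoʳ-≤ (3 ^ T) {{m^n≢0 3 T}} k≤s) (^-monoˡ-≤ s (1+entryCodes≤ k k≤s)) ⟩
      (3 ^ T) ^ s * (2 ^ (4 * T)) ^ s
        ≤⟨ *-monoˡ-≤ _ (^-monoˡ-≤ s (3^n≤2^2n T)) ⟩
      (2 ^ (2 * T)) ^ s * (2 ^ (4 * T)) ^ s
        ≡⟨ cong₂ _*_ (^-*-assoc 2 (2 * T) s) (^-*-assoc 2 (4 * T) s) ⟩
      2 ^ (2 * T * s) * 2 ^ (4 * T * s)
        ≡⟨ ^-distribˡ-+-* 2 (2 * T * s) (4 * T * s) ⟨
      2 ^ (2 * T * s + 4 * T * s) ∎
      where open ≤-Reasoning

  N≥1 : 1 ≤ N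
  N≥1 = *-mono-≤ {1} {8 * suc s} {1} {T} (s≤s z≤n) (≤-trans (s≤s z≤n) 1+s≤T)

  short : ∀ m → 1 ≤ s → 16 * a * s * m < a * N → m < T
  short m s≥1 lt = *-cancelˡ-< (16 * a * s) m T (<-≤-trans lt aN≤16asT)
    where
    open ≤-Reasoning
    aN≤16asT : a * N ≤ 16 * a * s * T
    aN≤16asT = begin
      a * (8 * suc s * T)               ≡⟨ split a s T ⟩
      8 * a * 1 * T + 8 * a * s * T     ≤⟨ +-monoˡ-≤ _ (*-monoˡ-≤ T (*-monoʳ-≤ (8 * a) s≥1)) ⟩
      8 * a * s * T + 8 * a * s * T     ≡⟨ merge a s T ⟩
      16 * a * s * T                    ∎
      where
      split : ∀ a s T → a * (8 * suc s * T) ≡ 8 * a * 1 * T + 8 * a * s * T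
      split = solve-∀
      merge : ∀ a s T → 8 * a * s * T + 8 * a * s * T ≡ 16 * a * s * T
      merge = solve-∀

  fits : ∀ k → k ≤ s → smallCodes s n₀ + bigCodes s T (2 * (a * N)) k < 2 ^ N
  fits k k≤s = <-≤-trans (+-<-2^ T _ smallCodes<2^T (bigCodes≤ k k≤s)) (^-monoʳ-≤ 2 exponent≤)
    where
    open ≤-Reasoning
    exponent≤ : suc (T + (2 * T * s + 4 * T * s)) ≤ N
    exponent≤ = begin
      suc (T + (2 * T * s + 4 * T * s))    ≤⟨ +-monoˡ-≤ _ (≤-trans (s≤s z≤n) 1+s≤T) ⟩
      T + (T + (2 * T * s + 4 * T * s))    ≤⟨ m≤m+n _ (6 * T + 2 * T * s) ⟩
      T + (T + (2 * T * s + 4 * T * s)) + (6 * T + 2 * T * s) ≡⟨ collect T s ⟩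
      8 * suc s * T                        ∎
      where
      collect : ∀ T s → T + (T + (2 * T * s + 4 * T * s)) + (6 * T + 2 * T * s) ≡ 8 * suc s * T
      collect = solve-∀

theorem4p1 : (s κ : ℕ) → 1 ≤ κ → (𝒞 : GraphClass) → DisjExpr s κ 𝒞 →
    (c : ℕ) → 2 ≤ c → (Π : PLS c 𝒞) →
    Σ ℕ λ d → 1 ≤ d × ((n₀ : ℕ) →
      Σ Graph λ G → Σ (Connected G) λ conn → Σ (Ids G) λ id →
      Σ (ValidIds c G id) λ vid → Σ (𝒞 G) λ g∈ →
        n₀ ≤ n G × n G ^ κ ≤ d * s * proofSize G (prover Π G conn id vid g∈))
theorem4p1 s κ κ≥1 𝒞 D c c≥2 Π = 16 * α ^ κ , *-mono-≤ {1} {16} (s≤s z≤n) αᵏ≥1 , Found.goodGraph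
  where
  open DisjExpr D using (α; α-pos; k)

  αᵏ≥1 : 1 ≤ α ^ κ
  αᵏ≥1 = subst (_≤ α ^ κ) (^-zeroˡ κ) (^-monoˡ-≤ κ α-pos)

  module P (n₀ : ℕ) = Parameters s (α ^ κ) n₀ αᵏ≥1
  module Found (n₀ : ℕ) = Counting κ≥1 D c≥2 Π n₀ (P.T n₀) (P.N n₀) (P.N≥1 n₀) (P.short n₀)
                                   (P.fits n₀ (k (P.N n₀)) (∣S∣≤s D (P.N n₀) (P.N≥1 n₀)))
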